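{- Let $X$ be a finite set and $f\in\mathrm{Bool}(X)$ such that $f(Y)\in\mathbb{N}$ for all $Y\subseteq X$. Then $\theta_1(f)$, defined by $\theta_1(f)(A)=\sum_{B\subseteq A}f(B)$, is rigid.
   Context: A boolean function on a finite set $X$ is a map $f:\mathcal{P}(X)\to\mathbb{Z}$ with $f(\emptyset)=0$; $\mathrm{Bool}(X)$ is the set of them. $f_{\mid Y}$ is restriction to $\mathcal{P}(Y)$; for disjoint $X,Y$, $f\star_1 g(A)=f(A\cap X)+g(A\cap Y)$. For nonempty $X$, $f$ is indecomposable if $f=f'\star_1f''$ with $f'\in\mathrm{Bool}(X\setminus Y)$, $f''\in\mathrm{Bool}(Y)$ forces $Y\in\{\emptyset,X\}$. Every $f$ decomposes uniquely as the $\star_1$-product of its restrictions to the classes (indecomposable components) of an equivalence $\sim_f^i$ on $X$, each restriction indecomposable. An indecomposable $f\in\mathrm{Bool}(X)$ is rigid if for all disjoint $A,B\subseteq X$ with $f(A\sqcup B)=f(A)+f(B)$, one has $f_{\mid A\sqcup B}=f_{\mid A}\star_1 f_{\mid B}$ (i.e. $f(A'\sqcup B')=f(A')+f(B')$ for all $A'\subseteq A$, $B'\subseteq B$). A general $f\in\mathrm{Bool}(X)$ is rigid if $f_{\mid Y}$ is rigid for every indecomposable component $Y$ of $f$. -}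

module Defs where

open import Data.Nat using (ℕ; zero; suc)
open import Data.Integer using (ℤ; _+_; +_)
open import Data.List using (List; []; _∷_; map; _++_; filter)
open import Data.List using () renaming (foldr to lfoldr)
open import Data.Bool using (Bool; true; false)
open import Data.Vec using (Vec; []; _∷_)
open import Data.Fin.Subset using (Subset; _⊆_; _∩_; _∪_; ∁; ⊥; Nonempty; inside; outside)
open import Data.Fin.Subset.Properties using (_⊆?_)
open import Relation.Binary.PropositionalEquality using (_≡_)
open import Data.Sum using (_⊎_)
open import Data.Product using (_×_)

-- A boolean function on X = Fin n: a map P(X) → ℤ (the condition f(∅)=0 is
-- imposed separately where needed).
BoolFun : ℕ → Set
BoolFun n = Subset n → ℤ

allSubsets : (n : ℕ) → List (Subset n)
allSubsets zero = [] ∷ []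
allSubsets (suc n) = map (outside ∷_) (allSubsets n) ++ map (inside ∷_) (allSubsets n)

θ₁ : {n : ℕ} → BoolFun n → BoolFun n
θ₁ {n} f A = lfoldr (λ B acc → f B + acc) (+ 0) (filter (_⊆? A) (allSubsets n))

_∖_ : {n : ℕ} → Subset n → Subset n → Subset n
A ∖ Z = A ∩ ∁ Z

-- f_{|Y} splits as f_{|Y∖Z} ⋆₁ f_{|Z}  (Z ⊆ Y):
-- for every A ⊆ Y, f(A) = f(A ∖ Z) + f(A ∩ Z).
SplitsAlong : {n : ℕ} → BoolFun n → Subset n → Subset n → Set
SplitsAlong f Y Z = ∀ A → A ⊆ Y → f A ≡ f (A ∖ Z) + f (A ∩ Z)

IndecomposableOn : {n : ℕ} → BoolFun n → Subset n → Set
IndecomposableOn {n} f Y =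
  Nonempty Y × (∀ Z → Z ⊆ Y → SplitsAlong f Y Z → Z ≡ ⊥ ⊎ Z ≡ Y)

-- Y is an indecomposable component of f ∈ Bool(Fin n):
-- f = f_{|Y} ⋆₁ f_{|X∖Y} and f_{|Y} is indecomposable.
IsComponent : {n : ℕ} → BoolFun n → Subset n → Set
IsComponent {n} f Y = SplitsAlong f (Data.Fin.Subset.⊤) Y × IndecomposableOn f Y

RigidOn : {n : ℕ} → BoolFun n → Subset n → Set
RigidOn f Y =
  ∀ A B → A ⊆ Y → B ⊆ Y → A ∩ B ≡ ⊥ →
  f (A ∪ B) ≡ f A + f B →
  ∀ A' B' → A' ⊆ A → B' ⊆ B → f (A' ∪ B') ≡ f A' + f B'

Rigid : {n : ℕ} → BoolFun n → Set
Rigid f = ∀ Y → IsComponent f Y → RigidOn f Y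

{-# OPTIONS --safe #-}
-- For disjoint A and B, θ₁ f (A ∪ B) − θ₁ f A − θ₁ f B is the cross term: the sum of
-- f C over the sets C ⊆ A ∪ B contained in neither A nor B.  For f ≥ 0 it is a sum of
-- nonnegative terms, and every set straddling A' ⊆ A and B' ⊆ B also straddles A and B,
-- so 0 ≤ crossTerm A' B' ≤ crossTerm A B.  Additivity on A ∪ B kills the latter,
-- hence the former, which is additivity on A' ∪ B'.
module Submission where

open import Defs
open import Data.Nat using (ℕ)
open import Data.Integer using (ℤ; +_; _≤_; _+_)
open import Data.Integer.Properties
  using ( ≤-refl; ≤-antisym; +-mono-≤; +-identityˡ; +-identityʳ
        ; +-commutativeSemigroup; +-0-abelianGroup)
open import Algebra.Properties.CommutativeSemigroup +-commutativeSemigroup using (interchange)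
open import Algebra.Properties.AbelianGroup +-0-abelianGroup using (identityʳ-unique)
open import Data.Fin.Subset using (Subset; ⊥; _⊆_; _∪_; _∩_; _∈_; _∉_)
open import Data.Fin.Subset.Properties
  using (_⊆?_; ⊆-trans; ∪-comm; p⊆p∪q; q⊆p∪q; Empty-unique; ∉⊥; x∈p∩q⁺; x∈p∪q⁻; x∈p∪q⁺)
open import Data.List using (List; []; _∷_; filter; foldr)
open import Data.Empty using (⊥-elim)
open import Data.Bool using (if_then_else_)
open import Data.Product using (_×_; _,_)
open import Data.Sum as Sum using ([_,_])
open import Relation.Nullary using (¬_; yes; no; does; contradiction)
open import Relation.Nullary.Decidable using (_×-dec_; ¬?)
open import Level using (0ℓ)
open import Relation.Unary using (Pred; Decidable)
open import Relation.Binary.PropositionalEquality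
  using (_≡_; refl; sym; trans; cong; cong₂; subst; module ≡-Reasoning)

∑ : {A : Set} → (A → ℤ) → List A → ℤ
∑ h []       = + 0
∑ h (x ∷ xs) = h x + ∑ h xs

module _ {A : Set} where

  ∑-cong : {g h : A → ℤ} → (∀ x → g x ≡ h x) → ∀ xs → ∑ g xs ≡ ∑ h xs
  ∑-cong g≡h []       = refl
  ∑-cong g≡h (x ∷ xs) = cong₂ _+_ (g≡h x) (∑-cong g≡h xs)

  ∑-distrib-+ : (g h : A → ℤ) → ∀ xs → ∑ (λ x → g x + h x) xs ≡ ∑ g xs + ∑ h xs
  ∑-distrib-+ g h []       = refl
  ∑-distrib-+ g h (x ∷ xs) =
    trans (cong (_+_ (g x + h x)) (∑-distrib-+ g h xs))
          (interchange (g x) (h x) (∑ g xs) (∑ h xs))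

  ∑-mono-≤ : {g h : A → ℤ} → (∀ x → g x ≤ h x) → ∀ xs → ∑ g xs ≤ ∑ h xs
  ∑-mono-≤ g≤h []       = ≤-refl
  ∑-mono-≤ g≤h (x ∷ xs) = +-mono-≤ (g≤h x) (∑-mono-≤ g≤h xs)

  ∑-nonneg : {h : A → ℤ} → (∀ x → + 0 ≤ h x) → ∀ xs → + 0 ≤ ∑ h xs
  ∑-nonneg 0≤h []       = ≤-refl
  ∑-nonneg 0≤h (x ∷ xs) = +-mono-≤ (0≤h x) (∑-nonneg 0≤h xs)

  restrict : {P : Pred A 0ℓ} → (A → ℤ) → Decidable P → A → ℤ
  restrict f P? x = if does (P? x) then f x else + 0

  foldr-filter≡∑-restrict : {P : Pred A 0ℓ} (f : A → ℤ) (P? : Decidable P) → ∀ xs →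
    foldr (λ x acc → f x + acc) (+ 0) (filter P? xs) ≡ ∑ (restrict f P?) xs
  foldr-filter≡∑-restrict f P? []       = refl
  foldr-filter≡∑-restrict f P? (x ∷ xs) with P? x
  ... | yes _ = cong (_+_ (f x)) (foldr-filter≡∑-restrict f P? xs)
  ... | no  _ = trans (foldr-filter≡∑-restrict f P? xs) (sym (+-identityˡ _))

  restrict-mono-≤ : {P Q : Pred A 0ℓ} {f : A → ℤ} (P? : Decidable P) (Q? : Decidable Q) →
    (∀ {x} → P x → Q x) → (∀ x → + 0 ≤ f x) → ∀ x → restrict f P? x ≤ restrict f Q? x
  restrict-mono-≤ P? Q? P⇒Q 0≤f x with P? x | Q? x
  ... | yes p | no ¬q = contradiction (P⇒Q p) ¬q
  ... | yes _ | yes _ = ≤-refl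
  ... | no  _ | yes _ = 0≤f x
  ... | no  _ | no  _ = ≤-refl

  restrict-nonneg : {P : Pred A 0ℓ} {f : A → ℤ} (P? : Decidable P) →
    (∀ x → + 0 ≤ f x) → ∀ x → + 0 ≤ restrict f P? x
  restrict-nonneg P? 0≤f x with P? x
  ... | yes _ = 0≤f x
  ... | no  _ = ≤-refl

module _ {n : ℕ} where

  Disjoint : Subset n → Subset n → Set
  Disjoint A B = ∀ {x} → x ∈ A → x ∉ B

  ∩≡⊥⇒Disjoint : {A B : Subset n} → A ∩ B ≡ ⊥ → Disjoint A B
  ∩≡⊥⇒Disjoint {A} {B} A∩B≡⊥ {x} x∈A x∈B = ∉⊥ (subst (x ∈_) A∩B≡⊥ (x∈p∩q⁺ (x∈A , x∈B)))

  Disjoint-mono : {A B A' B' : Subset n} → A' ⊆ A → B' ⊆ B → Disjoint A B → Disjoint A' B'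
  Disjoint-mono A'⊆A B'⊆B disj x∈A' x∈B' = disj (A'⊆A x∈A') (B'⊆B x∈B')

  ⊆-Disjoint⇒≡⊥ : {A B C : Subset n} → Disjoint A B → C ⊆ A → C ⊆ B → C ≡ ⊥
  ⊆-Disjoint⇒≡⊥ disj C⊆A C⊆B = Empty-unique λ where (x , x∈C) → disj (C⊆A x∈C) (C⊆B x∈C)

  ∪-mono-⊆ : {A B A' B' : Subset n} → A' ⊆ A → B' ⊆ B → A' ∪ B' ⊆ A ∪ B
  ∪-mono-⊆ {A' = A'} {B'} A'⊆A B'⊆B x∈A'∪B' =
    x∈p∪q⁺ (Sum.map A'⊆A B'⊆B (x∈p∪q⁻ A' B' x∈A'∪B'))

  ⊆∪-Disjoint⇒⊆ˡ : {C P Q : Subset n} → C ⊆ P ∪ Q → Disjoint C Q → C ⊆ P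
  ⊆∪-Disjoint⇒⊆ˡ {P = P} {Q} C⊆P∪Q disj x∈C =
    [ (λ x∈P → x∈P) , (λ x∈Q → contradiction x∈Q (disj x∈C)) ] (x∈p∪q⁻ P Q (C⊆P∪Q x∈C))

  ⊆∪-Disjoint⇒⊆ʳ : {C P Q : Subset n} → C ⊆ P ∪ Q → Disjoint C P → C ⊆ Q
  ⊆∪-Disjoint⇒⊆ʳ {C} {P} {Q} C⊆P∪Q = ⊆∪-Disjoint⇒⊆ˡ (subst (C ⊆_) (∪-comm P Q) C⊆P∪Q)

  Straddles : Subset n → Subset n → Pred (Subset n) 0ℓ
  Straddles A B C = C ⊆ A ∪ B × ¬ C ⊆ A × ¬ C ⊆ B

  straddles? : ∀ A B → Decidable (Straddles A B)
  straddles? A B C = C ⊆? (A ∪ B) ×-dec ¬? (C ⊆? A) ×-dec ¬? (C ⊆? B)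

  Straddles-mono : {A B A' B' C : Subset n} → Disjoint A B → A' ⊆ A → B' ⊆ B →
    Straddles A' B' C → Straddles A B C
  Straddles-mono disj A'⊆A B'⊆B (C⊆A'∪B' , C⊈A' , C⊈B') =
      ⊆-trans C⊆A'∪B' (∪-mono-⊆ A'⊆A B'⊆B)
    , (λ C⊆A → C⊈A' (⊆∪-Disjoint⇒⊆ˡ C⊆A'∪B' λ x∈C x∈B' → disj (C⊆A x∈C) (B'⊆B x∈B')))
    , (λ C⊆B → C⊈B' (⊆∪-Disjoint⇒⊆ʳ C⊆A'∪B' λ x∈C x∈A' → disj (A'⊆A x∈A') (C⊆B x∈C)))

module _ {n : ℕ} (f : Subset n → ℤ) where

  crossTerm : Subset n → Subset n → ℤ
  crossTerm A B = ∑ (restrict f (straddles? A B)) (allSubsets n)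

  -- ⊥ is counted in both θ₁ f A and θ₁ f B; f ⊥ ≡ + 0 makes the double count harmless.
  restrict-⊆∪-split : {A B : Subset n} → f ⊥ ≡ + 0 → Disjoint A B → ∀ C →
    restrict f (_⊆? (A ∪ B)) C
      ≡ restrict f (_⊆? A) C + restrict f (_⊆? B) C + restrict f (straddles? A B) C
  restrict-⊆∪-split {A} {B} f⊥≡0 disj C with C ⊆? (A ∪ B) | C ⊆? A | C ⊆? B
  ... | yes _ | yes C⊆A | yes C⊆B rewrite ⊆-Disjoint⇒≡⊥ disj C⊆A C⊆B | f⊥≡0 = refl
  ... | yes _ | yes _   | no  _   = sym (trans (+-identityʳ _) (+-identityʳ _))
  ... | yes _ | no  _   | yes _   = sym (trans (+-identityʳ _) (+-identityˡ _))
  ... | yes _ | no  _   | no  _   = sym (+-identityˡ (f C))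
  ... | no  C⊈A∪B | yes C⊆A | _   = ⊥-elim (C⊈A∪B (⊆-trans C⊆A (p⊆p∪q B)))
  ... | no  C⊈A∪B | no  _ | yes C⊆B = ⊥-elim (C⊈A∪B (⊆-trans C⊆B (q⊆p∪q A B)))
  ... | no  _ | no  _   | no  _   = refl

  θ₁≡∑restrict : ∀ A → θ₁ f A ≡ ∑ (restrict f (_⊆? A)) (allSubsets n)
  θ₁≡∑restrict A = foldr-filter≡∑-restrict f (_⊆? A) (allSubsets n)

  θ₁-∪ : {A B : Subset n} → f ⊥ ≡ + 0 → Disjoint A B →
    θ₁ f (A ∪ B) ≡ θ₁ f A + θ₁ f B + crossTerm A B
  θ₁-∪ {A} {B} f⊥≡0 disj = begin
    θ₁ f (A ∪ B)
      ≡⟨ θ₁≡∑restrict (A ∪ B) ⟩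
    ∑ (restrict f (_⊆? (A ∪ B))) L
      ≡⟨ ∑-cong (restrict-⊆∪-split f⊥≡0 disj) L ⟩
    ∑ (λ C → f⊆A C + f⊆B C + restrict f (straddles? A B) C) L
      ≡⟨ ∑-distrib-+ (λ C → f⊆A C + f⊆B C) _ L ⟩
    ∑ (λ C → f⊆A C + f⊆B C) L + crossTerm A B
      ≡⟨ cong (λ s → s + crossTerm A B) (∑-distrib-+ f⊆A f⊆B L) ⟩
    ∑ f⊆A L + ∑ f⊆B L + crossTerm A B
      ≡⟨ cong₂ (λ a b → a + b + crossTerm A B) (sym (θ₁≡∑restrict A)) (sym (θ₁≡∑restrict B)) ⟩
    θ₁ f A + θ₁ f B + crossTerm A B
      ∎
    where
    open ≡-Reasoning
    L = allSubsets n
    f⊆A = restrict f (_⊆? A)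
    f⊆B = restrict f (_⊆? B)

  crossTerm-nonneg : (∀ C → + 0 ≤ f C) → ∀ A B → + 0 ≤ crossTerm A B
  crossTerm-nonneg 0≤f A B = ∑-nonneg (restrict-nonneg (straddles? A B) 0≤f) (allSubsets n)

  crossTerm-mono-≤ : {A B A' B' : Subset n} → (∀ C → + 0 ≤ f C) → Disjoint A B →
    A' ⊆ A → B' ⊆ B → crossTerm A' B' ≤ crossTerm A B
  crossTerm-mono-≤ {A} {B} {A'} {B'} 0≤f disj A'⊆A B'⊆B =
    ∑-mono-≤ (restrict-mono-≤ (straddles? A' B') (straddles? A B)
                               (Straddles-mono disj A'⊆A B'⊆B) 0≤f)
             (allSubsets n)

  θ₁-additive⇒crossTerm≡0 : {A B : Subset n} → f ⊥ ≡ + 0 → Disjoint A B →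
    θ₁ f (A ∪ B) ≡ θ₁ f A + θ₁ f B → crossTerm A B ≡ + 0
  θ₁-additive⇒crossTerm≡0 {A} {B} f⊥≡0 disj additive =
    identityʳ-unique (θ₁ f A + θ₁ f B) (crossTerm A B) (trans (sym (θ₁-∪ f⊥≡0 disj)) additive)

  θ₁-additive-hereditary : {A B A' B' : Subset n} → f ⊥ ≡ + 0 → (∀ C → + 0 ≤ f C) →
    Disjoint A B → θ₁ f (A ∪ B) ≡ θ₁ f A + θ₁ f B →
    A' ⊆ A → B' ⊆ B → θ₁ f (A' ∪ B') ≡ θ₁ f A' + θ₁ f B'
  θ₁-additive-hereditary {A} {B} {A'} {B'} f⊥≡0 0≤f disj additive A'⊆A B'⊆B = begin
    θ₁ f (A' ∪ B')                      ≡⟨ θ₁-∪ f⊥≡0 (Disjoint-mono A'⊆A B'⊆B disj) ⟩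
    θ₁ f A' + θ₁ f B' + crossTerm A' B' ≡⟨ cong (_+_ (θ₁ f A' + θ₁ f B')) crossTerm′≡0 ⟩
    θ₁ f A' + θ₁ f B' + + 0             ≡⟨ +-identityʳ _ ⟩
    θ₁ f A' + θ₁ f B'                   ∎
    where
    open ≡-Reasoning
    crossTerm′≡0 : crossTerm A' B' ≡ + 0
    crossTerm′≡0 = ≤-antisym
      (subst (crossTerm A' B' ≤_) (θ₁-additive⇒crossTerm≡0 f⊥≡0 disj additive)
        (crossTerm-mono-≤ 0≤f disj A'⊆A B'⊆B))
      (crossTerm-nonneg 0≤f A' B')

proposition4p10 : (n : ℕ) (f : Subset n → ℤ) → f ⊥ ≡ + 0 →
    (∀ Y → + 0 ≤ f Y) → Rigid (θ₁ f)
proposition4p10 n f f⊥≡0 0≤f Y _ A B _ _ A∩B≡⊥ additive A' B' A'⊆A B'⊆B =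
  θ₁-additive-hereditary f f⊥≡0 0≤f (∩≡⊥⇒Disjoint A∩B≡⊥) additive A'⊆A B'⊆B
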